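{- Let $L$ be a complete lattice and $f\in\mathrm{FinAdd}_L$ be locally $^*$-closed. Then $f^*$ is locally $^*$-closed. If $f$ is additionally $\top$-continuous, then so is $f^*$.
   Context: Functions are written on the right and composed left to right: $xf$ is $f$ applied to $x$. For a complete lattice $L$ (least $\bot$, greatest $\top$), $f:L\to L$ is finitely additive if $\bot f=\bot$ and $(x\vee y)f=xf\vee yf$; $\mathrm{FinAdd}_L$ is the set of such maps, ordered pointwise with pointwise suprema; $\bot$ also denotes the constant $\bot$ map. $f^0=\mathrm{id}$, $f^{n+1}=f^nf$, $f^*=\bigvee_{n\ge0}f^n$ (pointwise), and $f^{**}=(f^*)^*$. $f$ is $\top$-continuous if $f=\bot$ or for every $X\subseteq L$ with $\bigvee X=\top$ we have $\bigvee_{x\in X}xf=\top$. $f$ is locally $^*$-closed if for each $x\in L$ either $xf^*=\top$ or there is $N\ge0$ with $xf^*=x\vee xf\vee\dots\vee xf^N$. -}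

module Defs where

open import Level using (Level; suc; _⊔_; Lift; lift)
open import Data.Nat using (ℕ; zero) renaming (suc to sucℕ)
open import Data.Bool using (Bool; true; false)
open import Data.Empty using (⊥)
open import Data.Product using (Σ; ∃; _×_)
open import Data.Sum using (_⊎_)
open import Relation.Binary.Structures using (IsPartialOrder)
open import Function.Definitions using (Congruent)

-- A complete lattice: a partial order (w.r.t. a setoid equality _≈_) in which
-- every family of elements indexed by a type in Set c (in particular every
-- subset of the carrier) has a least upper bound.
record CompleteLattice (c ℓ₁ ℓ₂ : Level) : Set (suc (c ⊔ ℓ₁ ⊔ ℓ₂)) where
  infix 4 _≈_ _≤_
  field
    Carrier        : Set c
    _≈_            : Carrier → Carrier → Set ℓ₁
    _≤_            : Carrier → Carrier → Set ℓ₂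
    isPartialOrder : IsPartialOrder _≈_ _≤_
    ⋁              : {I : Set c} → (I → Carrier) → Carrier
    ⋁-upper        : {I : Set c} (F : I → Carrier) (i : I) → F i ≤ ⋁ F
    ⋁-least        : {I : Set c} (F : I → Carrier) (z : Carrier) →
                     ((i : I) → F i ≤ z) → ⋁ F ≤ z

  infixl 6 _∨_
  _∨_ : Carrier → Carrier → Carrier
  x ∨ y = ⋁ {Lift c Bool} λ { (lift true) → x ; (lift false) → y }

  ⊥L : Carrier
  ⊥L = ⋁ {Lift c ⊥} λ ()

  ⊤L : Carrier
  ⊤L = ⋁ {Carrier} (λ x → x)

module _ {c ℓ₁ ℓ₂ : Level} (L : CompleteLattice c ℓ₁ ℓ₂) where
  open CompleteLattice L

  record FinAdd (f : Carrier → Carrier) : Set (c ⊔ ℓ₁) where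
    field
      cong-f : Congruent _≈_ _≈_ f
      f-⊥    : f ⊥L ≈ ⊥L
      f-∨    : ∀ x y → f (x ∨ y) ≈ f x ∨ f y

  -- f^n, written as a function: x f^0 = x, x f^(n+1) = (x f^n) f
  iter : (Carrier → Carrier) → ℕ → Carrier → Carrier
  iter f zero     x = x
  iter f (sucℕ n) x = f (iter f n x)

  star : (Carrier → Carrier) → Carrier → Carrier
  star f x = ⋁ {Lift c ℕ} λ { (lift n) → iter f n x }

  partialJoin : (Carrier → Carrier) → ℕ → Carrier → Carrier
  partialJoin f zero     x = x
  partialJoin f (sucℕ N) x = partialJoin f N x ∨ iter f (sucℕ N) x

  LocallyStarClosed : (Carrier → Carrier) → Set (c ⊔ ℓ₁)
  LocallyStarClosed f =
    (x : Carrier) → (star f x ≈ ⊤L) ⊎ (Σ ℕ λ N → star f x ≈ partialJoin f N x)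

  TopContinuous : (Carrier → Carrier) → Set (suc c ⊔ ℓ₁)
  TopContinuous f =
    ((x : Carrier) → f x ≈ ⊥L) ⊎
    ({I : Set c} (F : I → Carrier) → ⋁ F ≈ ⊤L → ⋁ (λ i → f (F i)) ≈ ⊤L)

module Submission where

-- Let g = f^*.  Two observations give the theorem.
--
-- (1) g is extensive (x ≤ x g, from the n = 0 term of the join), and every
--     extensive map h is ⊤-continuous: if ⋁ F = ⊤ then ⊤ = ⋁ F ≤ ⋁ (F h).
--     So the second claim holds even without ⊤-continuity of f.
--
-- (2) Local *-closedness of g at x.  If x f^* = ⊤ then x g^* ≥ x g = ⊤.
--     Otherwise x g = x ∨ x f ∨ … ∨ x f^N.  Since f is finitely additive,
--     f^n maps this finite join to x f^n ∨ … ∨ x f^(n+N) ≤ x g, hence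
--     x g g ≤ x g.  For any monotone g this "idempotence at x" gives
--     x g^(n+1) ≤ x g for all n, so x g^* = x ∨ x g, i.e. N = 1 works.

open import Defs
open import Level using (Level; _⊔_; lift)
open import Data.Product using (_×_; _,_)
open import Data.Sum using (inj₁; inj₂)
open import Data.Nat using (zero; suc; _+_)
open import Data.Bool using (true; false)
open import Relation.Binary.Structures using (IsPartialOrder)
open import Relation.Binary.PropositionalEquality using (_≡_; refl; cong)

module Order {c ℓ₁ ℓ₂ : Level} (L : CompleteLattice c ℓ₁ ℓ₂) where
  open CompleteLattice L public
  open IsPartialOrder isPartialOrder public
    renaming (refl to ≤-refl; trans to ≤-trans; reflexive to ≤-reflexive)

  Monotone : (Carrier → Carrier) → Set (c ⊔ ℓ₂)
  Monotone h = ∀ {x y} → x ≤ y → h x ≤ h y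

  Extensive : (Carrier → Carrier) → Set (c ⊔ ℓ₂)
  Extensive h = ∀ x → x ≤ h x

  ∨-upperˡ : ∀ x y → x ≤ x ∨ y
  ∨-upperˡ x y = ⋁-upper _ (lift true)

  ∨-upperʳ : ∀ x y → y ≤ x ∨ y
  ∨-upperʳ x y = ⋁-upper _ (lift false)

  ∨-least : ∀ {x y z} → x ≤ z → y ≤ z → x ∨ y ≤ z
  ∨-least {z = z} x≤z y≤z =
    ⋁-least _ z λ { (lift true) → x≤z ; (lift false) → y≤z }

  ≤-⊤ : ∀ x → x ≤ ⊤L
  ≤-⊤ x = ⋁-upper (λ x → x) x

  ⊤≤⇒≈⊤ : ∀ {x} → ⊤L ≤ x → x ≈ ⊤L
  ⊤≤⇒≈⊤ ⊤≤x = antisym (≤-⊤ _) ⊤≤x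

  iter-cong : ∀ {h} → (∀ {x y} → x ≈ y → h x ≈ h y) →
              ∀ n {x y} → x ≈ y → iter L h n x ≈ iter L h n y
  iter-cong h-cong zero    x≈y = x≈y
  iter-cong h-cong (suc n) x≈y = h-cong (iter-cong h-cong n x≈y)

  iter-mono : ∀ {h} → Monotone h → ∀ n → Monotone (iter L h n)
  iter-mono h-mono zero    x≤y = x≤y
  iter-mono h-mono (suc n) x≤y = h-mono (iter-mono h-mono n x≤y)

  iter-+ : ∀ h n m x → iter L h n (iter L h m x) ≡ iter L h (n + m) x
  iter-+ h zero    m x = refl
  iter-+ h (suc n) m x = cong h (iter-+ h n m x)

  iter≤star : ∀ h n x → iter L h n x ≤ star L h x
  iter≤star h n x = ⋁-upper _ (lift n)

  star-least : ∀ h x {z} → (∀ n → iter L h n x ≤ z) → star L h x ≤ z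
  star-least h x {z} bound = ⋁-least _ z λ { (lift n) → bound n }

  star-extensive : ∀ h → Extensive (star L h)
  star-extensive h = iter≤star h 0

  star-mono : ∀ {h} → Monotone h → Monotone (star L h)
  star-mono {h} h-mono {x} {y} x≤y =
    star-least h x λ n → ≤-trans (iter-mono h-mono n x≤y) (iter≤star h n y)

  star-top : ∀ h x → h x ≈ ⊤L → star L h x ≈ ⊤L
  star-top h x hx≈⊤ = ⊤≤⇒≈⊤ (≤-trans (≤-reflexive (Eq.sym hx≈⊤)) (iter≤star h 1 x))

  iter-suc≤ : ∀ {g} → Monotone g → ∀ x → g (g x) ≤ g x →
              ∀ n → iter L g (suc n) x ≤ g x
  iter-suc≤ g-mono x idem zero    = ≤-refl
  iter-suc≤ g-mono x idem (suc n) = ≤-trans (g-mono (iter-suc≤ g-mono x idem n)) idem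

  star-closes-in-one-step : ∀ {g} → Monotone g → ∀ x → g (g x) ≤ g x →
                            star L g x ≈ partialJoin L g 1 x
  star-closes-in-one-step {g} g-mono x idem = antisym
    (star-least g x λ
      { zero    → ∨-upperˡ x (g x)
      ; (suc n) → ≤-trans (iter-suc≤ g-mono x idem n) (∨-upperʳ x (g x)) })
    (∨-least (iter≤star g 0 x) (iter≤star g 1 x))

  extensive⇒topContinuous : ∀ {h} → Extensive h → TopContinuous L h
  extensive⇒topContinuous {h} h-ext = inj₂ λ F ⋁F≈⊤ → ⊤≤⇒≈⊤
    (≤-trans (≤-reflexive (Eq.sym ⋁F≈⊤))
      (⋁-least F _ λ i → ≤-trans (h-ext (F i)) (⋁-upper (λ i → h (F i)) i)))

module Additive {c ℓ₁ ℓ₂ : Level} (L : CompleteLattice c ℓ₁ ℓ₂)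
  {f : CompleteLattice.Carrier L → CompleteLattice.Carrier L}
  (fa : FinAdd L f) where
  open Order L
  open FinAdd fa

  -- Finitely additive maps are monotone: x ≤ y means x ∨ y ≈ y.
  f-mono : Monotone f
  f-mono {x} {y} x≤y =
    ≤-trans (∨-upperˡ (f x) (f y))
      (≤-trans (≤-reflexive (Eq.sym (f-∨ x y)))
        (≤-reflexive (cong-f (antisym (∨-least x≤y ≤-refl) (∨-upperʳ x y)))))

  -- Iterates of f are sub-additive (in fact additive, but ≤ suffices).
  iter-∨ : ∀ n a b → iter L f n (a ∨ b) ≤ iter L f n a ∨ iter L f n b
  iter-∨ zero    a b = ≤-refl
  iter-∨ (suc n) a b = ≤-trans (f-mono (iter-∨ n a b)) (≤-reflexive (f-∨ _ _))

  iter-partialJoin≤star : ∀ n N x → iter L f n (partialJoin L f N x) ≤ star L f x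
  iter-partialJoin≤star n zero    x = iter≤star f n x
  iter-partialJoin≤star n (suc N) x =
    ≤-trans (iter-∨ n _ _)
      (∨-least (iter-partialJoin≤star n N x)
        (≤-trans (≤-reflexive (Eq.reflexive (iter-+ f n (suc N) x)))
          (iter≤star f (n + suc N) x)))

  star-idempotent-at : ∀ x N → star L f x ≈ partialJoin L f N x →
                       star L f (star L f x) ≤ star L f x
  star-idempotent-at x N closed = star-least f (star L f x) λ n →
    ≤-trans (≤-reflexive (iter-cong cong-f n closed)) (iter-partialJoin≤star n N x)

  star-locallyStarClosed : LocallyStarClosed L f → LocallyStarClosed L (star L f)
  star-locallyStarClosed lsc x with lsc x
  ... | inj₁ top         = inj₁ (star-top (star L f) x top)
  ... | inj₂ (N , closed) =
    inj₂ (1 , star-closes-in-one-step (star-mono f-mono) x (star-idempotent-at x N closed))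

mainTheorem10 : {c ℓ₁ ℓ₂ : Level} (L : CompleteLattice c ℓ₁ ℓ₂)
    (f : CompleteLattice.Carrier L → CompleteLattice.Carrier L) →
    FinAdd L f → LocallyStarClosed L f →
    LocallyStarClosed L (star L f) × (TopContinuous L f → TopContinuous L (star L f))
mainTheorem10 L f fa lsc =
  Additive.star-locallyStarClosed L fa lsc ,
  λ _ → Order.extensive⇒topContinuous L (Order.star-extensive L f)
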